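{- If $(u,v)$ is a Hofstadter G pair, then $\delta(u,v)=-u+\phi^{ -1}v$ satisfies $-\phi^{ -1}<\delta(u,v)<\phi^{ -2}$.
   Context: $\phi=(1+\sqrt5)/2$. Hofstadter's G function is $G(x)=\lfloor\phi^{ -1}(x+1)\rfloor$ for integers $x\ge0$ (equivalently $G(0)=0$, $G(1)=1$, $G(x)=x-G(G(x-1))$). A Hofstadter G pair is a pair $(u,v)$ of positive integers with $u=G(v)$. -}

module Defs where

open import Data.Nat using (ℕ; zero; suc; _∸_)
open import Data.Integer as ℤ using (ℤ; +_; -[1+_])
open import Data.Product using (_×_)
open import Data.Sum using (_⊎_)
open import Relation.Nullary using (¬_)
open import Relation.Binary.PropositionalEquality using (_≡_)

-- Hofstadter's G function, via G(0)=0, G(1)=1, G(x)=x-G(G(x-1)).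
-- The nested recursion is made structural with a fuel argument;
-- fuel (suc x) is always sufficient for argument x (since G(y) ≤ y).

G-fuel : ℕ → ℕ → ℕ
G-fuel zero          _               = 0
G-fuel (suc f)       zero            = 0
G-fuel (suc f)       (suc zero)      = 1
G-fuel (suc f) (suc (suc n)) = suc (suc n) ∸ G-fuel f (G-fuel f (suc n))

G : ℕ → ℕ
G x = G-fuel (suc x) x

record GPair (u v : ℕ) : Set where
  field
    u-pos : 0 Data.Nat.< u
    v-pos : 0 Data.Nat.< v
    u≡Gv  : u ≡ G v

-- Exact real numbers of the form (a + b √5) / 2 with a b ∈ ℤ
-- (a subring of ℝ containing φ⁻¹, closed under the operations needed).

record Q5 : Set where
  constructor ⟨_,_⟩
  field
    re : ℤ
    ir : ℤ

open Q5 public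

-- a + b √5 > 0   (√5 irrational, so comparisons reduce to squares)
Pos : ℤ → ℤ → Set
Pos a b =
    (ℤ.0ℤ ℤ.≤ a × ℤ.0ℤ ℤ.≤ b × ¬ (a ≡ ℤ.0ℤ × b ≡ ℤ.0ℤ))
  ⊎ (ℤ.0ℤ ℤ.< a × b ℤ.< ℤ.0ℤ × (+ 5) ℤ.* (b ℤ.* b) ℤ.< a ℤ.* a)
  ⊎ (a ℤ.< ℤ.0ℤ × ℤ.0ℤ ℤ.< b × a ℤ.* a ℤ.< (+ 5) ℤ.* (b ℤ.* b))

infixl 6 _+ᵠ_ _-ᵠ_
infix 4 _<ᵠ_

_+ᵠ_ : Q5 → Q5 → Q5
⟨ a , b ⟩ +ᵠ ⟨ c , d ⟩ = ⟨ a ℤ.+ c , b ℤ.+ d ⟩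

-ᵠ_ : Q5 → Q5
-ᵠ ⟨ a , b ⟩ = ⟨ ℤ.- a , ℤ.- b ⟩

_-ᵠ_ : Q5 → Q5 → Q5
x -ᵠ y = x +ᵠ (-ᵠ y)

_<ᵠ_ : Q5 → Q5 → Set
x <ᵠ y = Pos (re (y -ᵠ x)) (ir (y -ᵠ x))

ℕ→Q5 : ℕ → Q5
ℕ→Q5 n = ⟨ + (2 Data.Nat.* n) , ℤ.0ℤ ⟩

_·ᵠ_ : ℕ → Q5 → Q5
n ·ᵠ ⟨ a , b ⟩ = ⟨ + n ℤ.* a , + n ℤ.* b ⟩

φ⁻¹ : Q5
φ⁻¹ = ⟨ ℤ.-1ℤ , ℤ.1ℤ ⟩

φ⁻² : Q5
φ⁻² = ⟨ + 3 , ℤ.-1ℤ ⟩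

δ : ℕ → ℕ → Q5
δ u v = -ᵠ ℕ→Q5 u +ᵠ (v ·ᵠ φ⁻¹)

{-# OPTIONS --safe #-}
-- Since φ⁻¹ is the positive root of x² + x = 1, for m > 0 the comparison of u with φ⁻¹ m is
-- the comparison of m u + u² with m², so ⌊φ⁻¹ m⌋ can be handled in ℕ. As G is given by its
-- recursion, the main step is G(v) = ⌊φ⁻¹ (v + 1)⌋, proved by strong induction on v.
-- The key fact is a reflection: as 1 − φ⁻¹ = φ⁻², writing m = u + c turns "u versus φ⁻¹ m"
-- into "c versus φ⁻¹ u", which identifies G(G(n − 1)) with n − ⌊φ⁻¹ (n + 1)⌋. The same
-- reflection gives the descent proving that φ is irrational, so no φ⁻¹ m is an integer.
-- Finally ⌊φ⁻¹ (v + 1)⌋ = u says that φ⁻¹ (v + 1) − 1 < u < φ⁻¹ (v + 1), which are the two bounds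
-- on δ(u, v) = −u + φ⁻¹ v, and in ℤ[√5] they are decided by squaring.
module Submission where

open import Data.Nat using (ℕ; zero; suc; _+_; _*_; _∸_; _≤_; _<_; z≤n; s≤s; z<s; s<s; _≤?_)
open import Data.Product using (_×_; _,_; proj₁; proj₂)
open import Defs

open import Data.Nat.Properties
open import Data.Nat.Induction using (Acc; acc; <-wellFounded; <-rec)
open import Data.Nat.Tactic.RingSolver using (solve-∀)
open import Data.Integer using (+_; -[1+_]; +<+; -<+; 0ℤ; 1ℤ; -1ℤ)
import Data.Integer as ℤ
import Data.Integer.Tactic.RingSolver as ℤ-Solver
open import Data.Sum using (_⊎_; inj₁; inj₂)
open import Data.Empty using (⊥-elim)
open import Relation.Nullary using (yes; no)
open import Relation.Binary using (tri<; tri≈; tri>)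
open import Relation.Binary.PropositionalEquality

infix 4 _<φ⁻¹·_ _>φ⁻¹·_

-- u < φ⁻¹ m and u > φ⁻¹ m respectively (for m > 0)
_<φ⁻¹·_ : ℕ → ℕ → Set
u <φ⁻¹· m = m * u + u * u < m * m

_>φ⁻¹·_ : ℕ → ℕ → Set
u >φ⁻¹· m = m * m < m * u + u * u

IsGoldenFloor : ℕ → ℕ → Set
IsGoldenFloor m u = u <φ⁻¹· m × suc u >φ⁻¹· m

<φ⁻¹·⇒< : ∀ {u m} → u <φ⁻¹· m → u < m
<φ⁻¹·⇒< {u} {m} h = ≰⇒> λ m≤u →
  <⇒≱ h (≤-trans (*-monoʳ-≤ m m≤u) (m≤m+n (m * u) (u * u)))

<φ⁻¹·∧>φ⁻¹·⇒< : ∀ {u w m} → u <φ⁻¹· m → w >φ⁻¹· m → u < w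
<φ⁻¹·∧>φ⁻¹·⇒< {u} {w} {m} below above = ≰⇒> λ w≤u →
  <-asym above (≤-<-trans (+-mono-≤ (*-monoʳ-≤ m w≤u) (*-mono-≤ w≤u w≤u)) below)

golden-floor-unique : ∀ {m u u′} → IsGoldenFloor m u → IsGoldenFloor m u′ → u ≡ u′
golden-floor-unique {m} (u<φm , φm<1+u) (u′<φm , φm<1+u′) =
  ≤-antisym (<⇒≤pred (<φ⁻¹·∧>φ⁻¹·⇒< {m = m} u<φm φm<1+u′))
            (<⇒≤pred (<φ⁻¹·∧>φ⁻¹·⇒< {m = m} u′<φm φm<1+u))

<φ⁻¹·-suc : ∀ {u m} → u <φ⁻¹· m → u <φ⁻¹· suc m
<φ⁻¹·-suc {u} {m} h = subst₂ _<_ (expand-lhs u m) (expand-rhs m)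
  (+-mono-<-≤ h (≤-trans (<⇒≤ (<φ⁻¹·⇒< h)) (≤-trans (m≤m+n m m) (m≤m+n (m + m) 1))))
  where
  expand-lhs : ∀ u m → (m * u + u * u) + u ≡ suc m * u + u * u
  expand-lhs = solve-∀
  expand-rhs : ∀ m → m * m + (m + m + 1) ≡ suc m * suc m
  expand-rhs = solve-∀

<φ⁻¹·⇒4*≤3*+1 : ∀ {u m} → u <φ⁻¹· m → 4 * u ≤ 3 * m + 1
<φ⁻¹·⇒4*≤3*+1 {u} {m} h = ≮⇒≥ λ 3m+1<4u → <⇒≱ (*-monoʳ-< 16 h) (begin
  16 * (m * m)                                      ≤⟨ m≤m+n _ _ ⟩
  16 * (m * m) + (5 * (m * m) + 10 * m + 1)         ≡⟨ bound-expand m ⟩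
  4 * m * (3 * m + 1) + (3 * m + 1) * (3 * m + 1)   ≤⟨ +-mono-≤ (*-monoʳ-≤ (4 * m) (<⇒≤ 3m+1<4u))
                                                                (*-mono-≤ (<⇒≤ 3m+1<4u) (<⇒≤ 3m+1<4u)) ⟩
  4 * m * (4 * u) + 4 * u * (4 * u)                 ≡⟨ scale-16 u m ⟩
  16 * (m * u + u * u)                              ∎)
  where
  open ≤-Reasoning
  bound-expand : ∀ m → 16 * (m * m) + (5 * (m * m) + 10 * m + 1) ≡ 4 * m * (3 * m + 1) + (3 * m + 1) * (3 * m + 1)
  bound-expand = solve-∀
  scale-16 : ∀ u m → 4 * m * (4 * u) + 4 * u * (4 * u) ≡ 16 * (m * u + u * u)
  scale-16 = solve-∀

<φ⁻¹·-suc-suc : ∀ {u m} → u <φ⁻¹· m → suc u <φ⁻¹· suc (suc m)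
<φ⁻¹·-suc-suc {u} {m} h = subst₂ _<_ (expand-lhs u m) (expand-rhs m)
  (+-mono-<-≤ h (subst (m + 4 * u + 3 ≤_) (excess m) (+-monoˡ-≤ 3 (+-monoʳ-≤ m (<φ⁻¹·⇒4*≤3*+1 {u} {m} h)))))
  where
  expand-lhs : ∀ u m → (m * u + u * u) + (m + 4 * u + 3) ≡ suc (suc m) * suc u + suc u * suc u
  expand-lhs = solve-∀
  expand-rhs : ∀ m → m * m + (4 * m + 4) ≡ suc (suc m) * suc (suc m)
  expand-rhs = solve-∀
  excess : ∀ m → m + (3 * m + 1) + 3 ≡ 4 * m + 4
  excess = solve-∀

>φ⁻¹·⇒<2* : ∀ {u m} → u >φ⁻¹· m → m < 2 * u
>φ⁻¹·⇒<2* {u} {m} h = ≰⇒> λ 2u≤m → <⇒≱ (*-monoʳ-< 4 h) (begin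
  4 * (m * u + u * u)                  ≡⟨ scale-4 u m ⟩
  2 * m * (2 * u) + 2 * u * (2 * u)    ≤⟨ +-mono-≤ (*-monoʳ-≤ (2 * m) 2u≤m) (*-mono-≤ 2u≤m 2u≤m) ⟩
  2 * m * m + m * m                    ≤⟨ m≤m+n _ (m * m) ⟩
  2 * m * m + m * m + m * m            ≡⟨ regroup m ⟩
  4 * (m * m)                          ∎)
  where
  open ≤-Reasoning
  scale-4 : ∀ u m → 4 * (m * u + u * u) ≡ 2 * m * (2 * u) + 2 * u * (2 * u)
  scale-4 = solve-∀
  regroup : ∀ m → 2 * m * m + m * m + m * m ≡ 4 * (m * m)
  regroup = solve-∀

>φ⁻¹·-suc : ∀ {u m} → u >φ⁻¹· m → suc u >φ⁻¹· suc m
>φ⁻¹·-suc {u} {m} h = subst₂ _<_ (expand-lhs m) (expand-rhs u m)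
  (+-mono-<-≤ h (subst₂ _≤_ (excess-lhs m) (excess-rhs u m)
    (+-monoʳ-≤ m (≤-trans (>φ⁻¹·⇒<2* h) (m≤m+n (2 * u) (u + 2))))))
  where
  expand-lhs : ∀ m → m * m + (2 * m + 1) ≡ suc m * suc m
  expand-lhs = solve-∀
  expand-rhs : ∀ u m → (m * u + u * u) + (m + 3 * u + 2) ≡ suc m * suc u + suc u * suc u
  expand-rhs = solve-∀
  excess-lhs : ∀ m → m + suc m ≡ 2 * m + 1
  excess-lhs = solve-∀
  excess-rhs : ∀ u m → m + (2 * u + (u + 2)) ≡ m + 3 * u + 2
  excess-rhs = solve-∀

-- With m = u + c, both sides of the comparison of u with φ⁻¹ m exceed the corresponding
-- sides of the comparison of c with φ⁻¹ u by u² + u c.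
reflection-square : ∀ u c → (u + c) * (u + c) ≡ (u * c + c * c) + (u * u + u * c)
reflection-square = solve-∀

reflection-product : ∀ u c → (u + c) * u + u * u ≡ u * u + (u * u + u * c)
reflection-product = solve-∀

>φ⁻¹·-reflect : ∀ u c → u >φ⁻¹· u + c → c <φ⁻¹· u
>φ⁻¹·-reflect u c h = +-cancelʳ-< (u * u + u * c) (u * c + c * c) (u * u)
  (subst₂ _<_ (reflection-square u c) (reflection-product u c) h)

<φ⁻¹·-reflect : ∀ u c → u <φ⁻¹· u + c → c >φ⁻¹· u
<φ⁻¹·-reflect u c h = +-cancelʳ-< (u * u + u * c) (u * u) (u * c + c * c)
  (subst₂ _<_ (reflection-product u c) (reflection-square u c) h)

≡φ⁻¹·-reflect : ∀ u c → (u + c) * (u + c) ≡ (u + c) * u + u * u → u * u ≡ u * c + c * c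
≡φ⁻¹·-reflect u c h = sym (+-cancelʳ-≡ (u * u + u * c) (u * c + c * c) (u * u)
  (trans (sym (reflection-square u c)) (trans h (reflection-product u c))))

golden-floor-reflect : ∀ {v c m} → v + c ≡ m → v >φ⁻¹· m → v <φ⁻¹· suc m → IsGoldenFloor v c
golden-floor-reflect {v} {c} refl above below =
  >φ⁻¹·-reflect v c above , <φ⁻¹·-reflect v (suc c) (subst (v <φ⁻¹·_) (sym (+-suc v c)) below)

φ-irrational : ∀ {m} u → 0 < m → m * m ≢ m * u + u * u
φ-irrational {m} = descent (<-wellFounded m)
  where
  descent : ∀ {m} → Acc _<_ m → ∀ u → 0 < m → m * m ≢ m * u + u * u
  descent {suc m} _ zero _ eq rewrite *-zeroʳ m with eq
  ... | ()
  descent {m} (acc smaller) u@(suc _) _ eq with m ≤? u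
  ... | yes m≤u = <-irrefl eq (≤-<-trans (*-monoʳ-≤ m m≤u) (m<m+n (m * u) z<s))
  ... | no m≰u with m≤n⇒∃[o]m+o≡n (<⇒≤ (≰⇒> m≰u))
  ...   | c , refl = descent (smaller (≰⇒> m≰u)) c z<s (≡φ⁻¹·-reflect u c eq)

golden-cmp : ∀ {m} u → 0 < m → u >φ⁻¹· m ⊎ u <φ⁻¹· m
golden-cmp {m} u 0<m with <-cmp (m * m) (m * u + u * u)
... | tri< above _ _ = inj₁ above
... | tri≈ _ tie _   = ⊥-elim (φ-irrational u 0<m tie)
... | tri> _ _ below = inj₂ below

G-fuel-≤ : ∀ f x → G-fuel f x ≤ x
G-fuel-≤ zero    _             = z≤n
G-fuel-≤ (suc f) zero          = z≤n
G-fuel-≤ (suc f) (suc zero)    = ≤-refl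
G-fuel-≤ (suc f) (suc (suc x)) = m∸n≤m (suc (suc x)) (G-fuel f (G-fuel f (suc x)))

G-≤ : ∀ x → G x ≤ x
G-≤ x = G-fuel-≤ (suc x) x

G-fuel-irrelevant : ∀ {f f′} x → x < f → x < f′ → G-fuel f x ≡ G-fuel f′ x
G-fuel-irrelevant {suc f} {suc f′} zero          _ _ = refl
G-fuel-irrelevant {suc f} {suc f′} (suc zero)    _ _ = refl
G-fuel-irrelevant {suc f} {suc f′} (suc (suc x)) (s<s x<f) (s<s x<f′) =
  cong (suc (suc x) ∸_) (begin
    G-fuel f (G-fuel f (suc x))    ≡⟨ cong (G-fuel f) (G-fuel-irrelevant (suc x) x<f x<f′) ⟩
    G-fuel f (G-fuel f′ (suc x))   ≡⟨ G-fuel-irrelevant _ (≤-<-trans (G-fuel-≤ f′ (suc x)) x<f)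
                                                          (≤-<-trans (G-fuel-≤ f′ (suc x)) x<f′) ⟩
    G-fuel f′ (G-fuel f′ (suc x))  ∎)
  where open ≡-Reasoning

G-suc-suc : ∀ k → G (suc (suc k)) ≡ suc (suc k) ∸ G (G (suc k))
G-suc-suc k = cong (suc (suc k) ∸_)
  (G-fuel-irrelevant (G (suc k)) (s≤s (G-≤ (suc k))) (n<1+n (G (suc k))))

G-suc-suc-≡ : ∀ {k b c} → b + c ≡ suc (suc k) → G (G (suc k)) ≡ c → G (suc (suc k)) ≡ b
G-suc-suc-≡ {k} {b} {c} b+c≡N GGk≡c = begin
  G (suc (suc k))              ≡⟨ G-suc-suc k ⟩
  suc (suc k) ∸ G (G (suc k))  ≡⟨ cong₂ _∸_ (sym b+c≡N) GGk≡c ⟩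
  b + c ∸ c                    ≡⟨ m+n∸n≡m b c ⟩
  b                            ∎
  where open ≡-Reasoning

G-golden-floor-step : ∀ k → IsGoldenFloor (suc (suc k)) (G (suc k))
                    → IsGoldenFloor (suc (G (suc k))) (G (G (suc k)))
                    → IsGoldenFloor (suc (suc (suc k))) (G (suc (suc k)))
G-golden-floor-step k (a<φN , φN<1+a) Ga-floor = by-cases (golden-cmp {suc N} (suc a) z<s)
  where
  N = suc (suc k)
  a = G (suc k)

  conclude : ∀ {b c} → b + c ≡ N → IsGoldenFloor (suc a) c → IsGoldenFloor (suc N) b
           → IsGoldenFloor (suc N) (G N)
  conclude b+c≡N c-floor b-floor = subst (IsGoldenFloor (suc N))
    (sym (G-suc-suc-≡ b+c≡N (golden-floor-unique {suc a} Ga-floor c-floor))) b-floor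

  by-cases : suc a >φ⁻¹· suc N ⊎ suc a <φ⁻¹· suc N → IsGoldenFloor (suc N) (G N)
  by-cases (inj₁ φN′<1+a) = conclude a+c≡N
      (golden-floor-reflect (cong suc a+c≡N) φN′<1+a (<φ⁻¹·-suc-suc {a} {N} a<φN))
      (<φ⁻¹·-suc {a} {N} a<φN , φN′<1+a)
    where a+c≡N = m+[n∸m]≡n (m≤n⇒m≤1+n (G-≤ (suc k)))
  by-cases (inj₂ 1+a<φN′) = conclude 1+a+c≡N
      (golden-floor-reflect 1+a+c≡N φN<1+a 1+a<φN′)
      (1+a<φN′ , >φ⁻¹·-suc {suc a} {N} φN<1+a)
    where 1+a+c≡N = m+[n∸m]≡n (s≤s (G-≤ (suc k)))

G-golden-floor : ∀ n → IsGoldenFloor (suc n) (G n)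
G-golden-floor = <-rec (λ n → IsGoldenFloor (suc n) (G n)) step
  where
  step : ∀ n → (∀ {m} → m < n → IsGoldenFloor (suc m) (G m)) → IsGoldenFloor (suc n) (G n)
  step zero          _       = z<s , s<s z<s
  step (suc zero)    _       = n<1+n 3 , m≤m+n 5 3
  step (suc (suc k)) earlier =
    G-golden-floor-step k (earlier (n<1+n (suc k))) (earlier (s≤s (G-≤ (suc k))))

completed-square : ∀ u m → (2 * u + m) * (2 * u + m) ≡ 4 * (m * u + u * u) + m * m
completed-square = solve-∀

five-squares : ∀ m → 5 * (m * m) ≡ 4 * (m * m) + m * m
five-squares = solve-∀

<φ⁻¹·⇒square<5*square : ∀ {u m} → u <φ⁻¹· m → (2 * u + m) * (2 * u + m) < 5 * (m * m)
<φ⁻¹·⇒square<5*square {u} {m} h = subst₂ _<_ (sym (completed-square u m)) (sym (five-squares m))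
  (+-monoˡ-< (m * m) (*-monoʳ-< 4 h))

>φ⁻¹·⇒5*square<square : ∀ {u m} → u >φ⁻¹· m → 5 * (m * m) < (2 * u + m) * (2 * u + m)
>φ⁻¹·⇒5*square<square {u} {m} h = subst₂ _<_ (sym (five-squares m)) (sym (completed-square u m))
  (+-monoˡ-< (m * m) (*-monoʳ-< 4 h))

Pos⇒<ᵠ : ∀ x y {d} → y -ᵠ x ≡ d → Pos (re d) (ir d) → x <ᵠ y
Pos⇒<ᵠ _ _ refl pos = pos

δ-+φ⁻¹ : ∀ u v → δ u v -ᵠ (-ᵠ φ⁻¹) ≡ ⟨ -[1+ 2 * u + v ] , + suc v ⟩
δ-+φ⁻¹ u v = cong₂ ⟨_,_⟩ (re-gap (+ (2 * u)) (+ v)) (ir-gap (+ v))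
  where
  re-gap : ∀ U V → (ℤ.- U ℤ.+ V ℤ.* -1ℤ) ℤ.+ ℤ.- (ℤ.- -1ℤ) ≡ ℤ.- (1ℤ ℤ.+ (U ℤ.+ V))
  re-gap = ℤ-Solver.solve-∀
  ir-gap : ∀ V → (ℤ.- 0ℤ ℤ.+ V ℤ.* 1ℤ) ℤ.+ ℤ.- (ℤ.- 1ℤ) ≡ 1ℤ ℤ.+ V
  ir-gap = ℤ-Solver.solve-∀

φ⁻²-δ : ∀ u v → φ⁻² -ᵠ δ u v ≡ ⟨ + (3 + (2 * u + v)) , -[1+ v ] ⟩
φ⁻²-δ u v = cong₂ ⟨_,_⟩ (re-gap (+ (2 * u)) (+ v)) (ir-gap (+ v))
  where
  re-gap : ∀ U V → + 3 ℤ.+ ℤ.- (ℤ.- U ℤ.+ V ℤ.* -1ℤ) ≡ + 3 ℤ.+ (U ℤ.+ V)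
  re-gap = ℤ-Solver.solve-∀
  ir-gap : ∀ V → -1ℤ ℤ.+ ℤ.- (ℤ.- 0ℤ ℤ.+ V ℤ.* 1ℤ) ≡ ℤ.- (1ℤ ℤ.+ V)
  ir-gap = ℤ-Solver.solve-∀

lemma7 : (u v : ℕ) → GPair u v →
    ((-ᵠ φ⁻¹) <ᵠ δ u v) × (δ u v <ᵠ φ⁻²)
lemma7 u v gp =
    Pos⇒<ᵠ (-ᵠ φ⁻¹) (δ u v) (δ-+φ⁻¹ u v) (inj₂ (inj₂ (-<+ , +<+ z<s , +<+ lower)))
  , Pos⇒<ᵠ (δ u v) φ⁻² (φ⁻²-δ u v) (inj₂ (inj₁ (+<+ z<s , -<+ , +<+ upper)))
  where
  u-floor : IsGoldenFloor (suc v) u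
  u-floor = subst (IsGoldenFloor (suc v)) (sym (GPair.u≡Gv gp)) (G-golden-floor v)

  lower : suc (2 * u + v) * suc (2 * u + v) < 5 * (suc v * suc v)
  lower = subst (λ w → w * w < 5 * (suc v * suc v)) (+-suc (2 * u) v)
    (<φ⁻¹·⇒square<5*square {u} (proj₁ u-floor))

  2*[1+u]+[1+v] : ∀ u v → 2 * suc u + suc v ≡ 3 + (2 * u + v)
  2*[1+u]+[1+v] = solve-∀

  upper : 5 * (suc v * suc v) < (3 + (2 * u + v)) * (3 + (2 * u + v))
  upper = subst (λ w → 5 * (suc v * suc v) < w * w) (2*[1+u]+[1+v] u v)
    (>φ⁻¹·⇒5*square<square {suc u} (proj₂ u-floor))
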